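{- Let $A$ be a formula of $\mathcal{L}_1$ such that $\mathbf{PRA}+(\varphi)\vdash A$ (i.e. $A$ is provable without any instance of the $(\chi)$-axiom). Then $[\![A]\!]_\xi(s)=\mathsf{true}$ for every environment $\xi$ and every state $s$; in particular the trivial realizer $\lambda s.\bot$ satisfies $\lambda s.\bot\Vdash\vec\alpha:A$ for all $\vec\alpha$.
   Context: $\mathcal{L}_0$ is the quantifier-free language of primitive recursive arithmetic: variables, $0$, $\mathsf{succ}$, a function symbol for each primitive recursive function, a predicate symbol for each syntactic definition of a primitive recursive predicate (including $=$), connectives $\neg,\wedge,\vee,\rightarrow$. $\mathcal{L}_1$ adds, for each $(k+1)$-ary predicate symbol $P$, a $k$-ary function symbol $\varphi_P$ and a $k$-ary predicate symbol $\chi_P$. $\mathbf{PRA}+(\varphi)$ is the theory in $\mathcal{L}_1$ with the logical axioms of intuitionistic predicate calculus with equality, the defining equations of primitive recursive functions, $\neg\,\mathsf{succ}(0)=0$, all instances of $(\varphi)$: $\chi_P(\vec{x})\rightarrow P(\vec{x},\varphi_P(\vec{x}))$, and rules modus ponens, substitution (from $A(x)$ infer $A(t)$ when $A(x)$ derived from hypotheses not containing $x$) and induction (from $A(0)$ and $A(x)\rightarrow A(\mathsf{succ}(x))$ infer $A(y)$). A state is a finite set $s$ of triples $\langle P,\vec m,n\rangle$ with $P(\vec m,n)$ true in the standard model and with at most one $n$ for each $(P,\vec m)$; $\mathbb{S}$ is the set of states, $\bot=\emptyset$. $\mathcal{S}X$ is the set of functions $\mathbb{S}\to X$. $[\![\chi_P]\!](\vec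 m,s)=\mathsf{true}$ iff some $\langle P,\vec m,n\rangle\in s$; $[\![\varphi_P]\!](\vec m,s)$ is that $n$, or $0$ if none. For an environment $\xi:\mathrm{Var}\to\mathcal{S}\mathbb{N}$: $[\![x]\!]_\xi=\xi(x)$, $[\![0]\!]_\xi=\lambda s.0$, function and predicate symbols of $\mathcal{L}_0$ are interpreted pointwise by their standard meanings, $[\![\varphi_P(\vec t)]\!]_\xi(s)=[\![\varphi_P]\!]([\![\vec t]\!]_\xi(s),s)$, $[\![\chi_P(\vec t)]\!]_\xi(s)=[\![\chi_P]\!]([\![\vec t]\!]_\xi(s),s)$, connectives pointwise boolean. For a map $r:\mathbb{S}\to\mathbb{S}$ with $\mathrm{Prefix}(r)=\{s\mid r(s)\subseteq s\}$, and $A$ with free variables among $x_1,\ldots,x_k$, $r\Vdash\vec\alpha:A$ means $[\![A]\!]_{[\lambda\_.\alpha_i(s)/x_i]}(s)=\mathsf{true}$ for all $s\in\mathrm{Prefix}(r)$. -}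

module Defs where

open import Data.Nat using (ℕ; zero; suc; _≡ᵇ_)
open import Data.Fin using (Fin; toℕ)
import Data.Unit
open import Data.Bool using (Bool; true; false; not; _∧_; _∨_)
open import Data.Vec using (Vec; []; _∷_; _∷ʳ_; lookup; map)
open import Data.List using (List; []; _∷_)
open import Data.List.Membership.Propositional using (_∈_)
open import Data.List.Relation.Unary.All using (All)
open import Data.Maybe using (Maybe; just; nothing; is-just; maybe)
open import Data.Product using (Σ; _×_; _,_)
open import Relation.Binary.PropositionalEquality using (_≡_)

data PR : ℕ → Set where
  Z : PR 0
  S : PR 1
  P : {n : ℕ} → Fin n → PR n
  C : {k n : ℕ} → PR k → Vec (PR n) k → PR n
  R : {n : ℕ} → PR n → PR (suc (suc n)) → PR (suc n)

mutual
  evalPR : {n : ℕ} → PR n → Vec ℕ n → ℕ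
  evalPR Z [] = 0
  evalPR S (x ∷ []) = suc x
  evalPR (P i) xs = lookup xs i
  evalPR (C f gs) xs = evalPR f (evalPRV gs xs)
  evalPR (R g h) (x ∷ ys) = recPR g h x ys

  evalPRV : {n k : ℕ} → Vec (PR n) k → Vec ℕ n → Vec ℕ k
  evalPRV [] xs = []
  evalPRV (g ∷ gs) xs = evalPR g xs ∷ evalPRV gs xs

  recPR : {n : ℕ} → PR n → PR (suc (suc n)) → ℕ → Vec ℕ n → ℕ
  recPR g h zero ys = evalPR g ys
  recPR g h (suc x) ys = evalPR h (x ∷ recPR g h x ys ∷ ys)

mutual
  eqPR : {a b : ℕ} → PR a → PR b → Bool
  eqPR Z Z = true
  eqPR S S = true
  eqPR (P {a} i) (P {b} j) = (a ≡ᵇ b) ∧ (toℕ i ≡ᵇ toℕ j)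
  eqPR (C {k} {a} f gs) (C {k'} {b} f' gs') = (a ≡ᵇ b) ∧ (eqPR f f' ∧ eqPRV gs gs')
  eqPR (R g h) (R g' h') = eqPR g g' ∧ eqPR h h'
  eqPR _ _ = false

  eqPRV : {a b m n : ℕ} → Vec (PR a) m → Vec (PR b) n → Bool
  eqPRV [] [] = true
  eqPRV (x ∷ xs) (y ∷ ys) = eqPR x y ∧ eqPRV xs ys
  eqPRV _ _ = false

eqVecℕ : {a b : ℕ} → Vec ℕ a → Vec ℕ b → Bool
eqVecℕ [] [] = true
eqVecℕ (x ∷ xs) (y ∷ ys) = (x ≡ᵇ y) ∧ eqVecℕ xs ys
eqVecℕ _ _ = false

-- Predicate symbols of L0: equality, and one symbol for each syntactic
-- definition of a primitive recursive predicate, given by a code f of its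
-- characteristic function (the predicate holds at xs iff f(xs) = 0).

data PredSym : ℕ → Set where
  eqP : PredSym 2
  prP : {k : ℕ} → PR k → PredSym k

eqPS : {a b : ℕ} → PredSym a → PredSym b → Bool
eqPS eqP eqP = true
eqPS (prP f) (prP g) = eqPR f g
eqPS _ _ = false

holdsP : {k : ℕ} → PredSym k → Vec ℕ k → Bool
holdsP eqP (a ∷ b ∷ []) = a ≡ᵇ b
holdsP (prP f) xs = evalPR f xs ≡ᵇ 0

Var : Set
Var = ℕ

data Term : Set where
  var  : Var → Term
  zer  : Term
  succ : Term → Term
  fn   : {k : ℕ} → PR k → Vec Term k → Term
  φ    : {k : ℕ} → PredSym (suc k) → Vec Term k → Term

data Form : Set where
  atom : {k : ℕ} → PredSym k → Vec Term k → Form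
  χ    : {k : ℕ} → PredSym (suc k) → Vec Term k → Form
  ¬'_  : Form → Form
  _∧'_ : Form → Form → Form
  _∨'_ : Form → Form → Form
  _⇒_  : Form → Form → Form

infixr 4 _⇒_
infixr 6 _∧'_
infixr 5 _∨'_

_≐_ : Term → Term → Form
t ≐ u = atom eqP (t ∷ u ∷ [])

mutual
  substT : Var → Term → Term → Term
  substT x t (var y) with x ≡ᵇ y
  ... | true = t
  ... | false = var y
  substT x t zer = zer
  substT x t (succ u) = succ (substT x t u)
  substT x t (fn f us) = fn f (substV x t us)
  substT x t (φ p us) = φ p (substV x t us)

  substV : {k : ℕ} → Var → Term → Vec Term k → Vec Term k
  substV x t [] = []
  substV x t (u ∷ us) = substT x t u ∷ substV x t us

substF : Var → Term → Form → Form
substF x t (atom p us) = atom p (substV x t us)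
substF x t (χ p us) = χ p (substV x t us)
substF x t (¬' A) = ¬' substF x t A
substF x t (A ∧' B) = substF x t A ∧' substF x t B
substF x t (A ∨' B) = substF x t A ∨' substF x t B
substF x t (A ⇒ B) = substF x t A ⇒ substF x t B

mutual
  VarsBelowT : ℕ → Term → Set
  VarsBelowT k (var y) = Data.Nat._<_ y k
  VarsBelowT k zer = Data.Unit.⊤
  VarsBelowT k (succ u) = VarsBelowT k u
  VarsBelowT k (fn f us) = VarsBelowV k us
  VarsBelowT k (φ p us) = VarsBelowV k us

  VarsBelowV : {m : ℕ} → ℕ → Vec Term m → Set
  VarsBelowV k [] = Data.Unit.⊤
  VarsBelowV k (u ∷ us) = VarsBelowT k u × VarsBelowV k us

VarsBelowF : ℕ → Form → Set
VarsBelowF k (atom p us) = VarsBelowV k us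
VarsBelowF k (χ p us) = VarsBelowV k us
VarsBelowF k (¬' A) = VarsBelowF k A
VarsBelowF k (A ∧' B) = VarsBelowF k A × VarsBelowF k B
VarsBelowF k (A ∨' B) = VarsBelowF k A × VarsBelowF k B
VarsBelowF k (A ⇒ B) = VarsBelowF k A × VarsBelowF k B

-- The theory PRA + (φ): theorems derivable without hypotheses.
-- (Hilbert style; since no rule discharges hypotheses, derivations of a
-- closed-off theorem use no hypotheses at all, so the side condition of
-- the substitution rule is vacuous.)

data ⊢_ : Form → Set where
  ax1  : ∀ A B → ⊢ (A ⇒ B ⇒ A)
  ax2  : ∀ A B C → ⊢ ((A ⇒ B) ⇒ (A ⇒ B ⇒ C) ⇒ (A ⇒ C))
  ax3  : ∀ A B → ⊢ (A ⇒ B ⇒ (A ∧' B))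
  ax4  : ∀ A B → ⊢ ((A ∧' B) ⇒ A)
  ax5  : ∀ A B → ⊢ ((A ∧' B) ⇒ B)
  ax6  : ∀ A B → ⊢ (A ⇒ (A ∨' B))
  ax7  : ∀ A B → ⊢ (B ⇒ (A ∨' B))
  ax8  : ∀ A B C → ⊢ ((A ⇒ C) ⇒ (B ⇒ C) ⇒ ((A ∨' B) ⇒ C))
  ax9  : ∀ A B → ⊢ ((A ⇒ B) ⇒ (A ⇒ ¬' B) ⇒ ¬' A)
  ax10 : ∀ A B → ⊢ (¬' A ⇒ A ⇒ B)
  eq-refl : ∀ t → ⊢ (t ≐ t)
  eq-subst : ∀ x t u A → ⊢ ((t ≐ u) ⇒ substF x t A ⇒ substF x u A)
  defZ : ⊢ (fn Z [] ≐ zer)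
  defS : ∀ t → ⊢ (fn S (t ∷ []) ≐ succ t)
  defP : ∀ {n} (i : Fin n) (ts : Vec Term n) → ⊢ (fn (P i) ts ≐ lookup ts i)
  defC : ∀ {k n} (f : PR k) (gs : Vec (PR n) k) (ts : Vec Term n) →
         ⊢ (fn (C f gs) ts ≐ fn f (map (λ g → fn g ts) gs))
  defR0 : ∀ {n} (g : PR n) (h : PR (suc (suc n))) (ts : Vec Term n) →
          ⊢ (fn (R g h) (zer ∷ ts) ≐ fn g ts)
  defRS : ∀ {n} (g : PR n) (h : PR (suc (suc n))) (t : Term) (ts : Vec Term n) →
          ⊢ (fn (R g h) (succ t ∷ ts) ≐ fn h (t ∷ fn (R g h) (t ∷ ts) ∷ ts))
  defPr₁ : ∀ {k} (f : PR k) (ts : Vec Term k) → ⊢ (atom (prP f) ts ⇒ (fn f ts ≐ zer))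
  defPr₂ : ∀ {k} (f : PR k) (ts : Vec Term k) → ⊢ ((fn f ts ≐ zer) ⇒ atom (prP f) ts)
  succ≠0 : ⊢ (¬' (succ zer ≐ zer))
  axφ : ∀ {k} (p : PredSym (suc k)) (ts : Vec Term k) →
        ⊢ (χ p ts ⇒ atom p (ts ∷ʳ φ p ts))
  mp : ∀ {A B} → ⊢ (A ⇒ B) → ⊢ A → ⊢ B
  sub : ∀ {A} x t → ⊢ A → ⊢ substF x t A
  ind : ∀ {A} x y → ⊢ substF x zer A → ⊢ (A ⇒ substF x (succ (var x)) A) →
        ⊢ substF x (var y) A

record Entry : Set where
  constructor ⟨_,_,_⟩
  field
    {arity} : ℕ
    pred : PredSym (suc arity)
    args : Vec ℕ arity
    val  : ℕ
open Entry public

key : Entry → Σ ℕ (λ k → PredSym (suc k) × Vec ℕ k)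
key e = arity e , pred e , args e

record State : Set where
  field
    entries : List Entry
    sound   : All (λ e → holdsP (pred e) (args e ∷ʳ val e) ≡ true) entries
    functional : ∀ {e e'} → e ∈ entries → e' ∈ entries → key e ≡ key e' → val e ≡ val e'
open State public

⊥ₛ : State
⊥ₛ = record { entries = [] ; sound = Data.List.Relation.Unary.All.[] ; functional = λ () }

_⊆ₛ_ : State → State → Set
s ⊆ₛ s' = ∀ {e} → e ∈ entries s → e ∈ entries s'

findEntry : {k : ℕ} → List Entry → PredSym (suc k) → Vec ℕ k → Maybe ℕ
findEntry [] p ms = nothing
findEntry (e ∷ es) p ms with eqPS (pred e) p ∧ eqVecℕ (args e) ms
... | true = just (val e)
... | false = findEntry es p ms

semχ : {k : ℕ} → PredSym (suc k) → Vec ℕ k → State → Bool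
semχ p ms s = is-just (findEntry (entries s) p ms)

semφ : {k : ℕ} → PredSym (suc k) → Vec ℕ k → State → ℕ
semφ p ms s = maybe (λ n → n) 0 (findEntry (entries s) p ms)

SN : Set
SN = State → ℕ

Env : Set
Env = Var → SN

mutual
  ⟦_⟧ᵗ : Term → Env → State → ℕ
  ⟦ var x ⟧ᵗ ξ s = ξ x s
  ⟦ zer ⟧ᵗ ξ s = 0
  ⟦ succ t ⟧ᵗ ξ s = suc (⟦ t ⟧ᵗ ξ s)
  ⟦ fn f ts ⟧ᵗ ξ s = evalPR f (⟦ ts ⟧ᵛ ξ s)
  ⟦ φ p ts ⟧ᵗ ξ s = semφ p (⟦ ts ⟧ᵛ ξ s) s

  ⟦_⟧ᵛ : {k : ℕ} → Vec Term k → Env → State → Vec ℕ k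
  ⟦ [] ⟧ᵛ ξ s = []
  ⟦ t ∷ ts ⟧ᵛ ξ s = ⟦ t ⟧ᵗ ξ s ∷ ⟦ ts ⟧ᵛ ξ s

⟦_⟧ᶠ : Form → Env → State → Bool
⟦ atom p ts ⟧ᶠ ξ s = holdsP p (⟦ ts ⟧ᵛ ξ s)
⟦ χ p ts ⟧ᶠ ξ s = semχ p (⟦ ts ⟧ᵛ ξ s) s
⟦ ¬' A ⟧ᶠ ξ s = not (⟦ A ⟧ᶠ ξ s)
⟦ A ∧' B ⟧ᶠ ξ s = ⟦ A ⟧ᶠ ξ s ∧ ⟦ B ⟧ᶠ ξ s
⟦ A ∨' B ⟧ᶠ ξ s = ⟦ A ⟧ᶠ ξ s ∨ ⟦ B ⟧ᶠ ξ s
⟦ A ⇒ B ⟧ᶠ ξ s = not (⟦ A ⟧ᶠ ξ s) ∨ ⟦ B ⟧ᶠ ξ s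

-- Realizability  r ⊩ α⃗ : A   (variables x_1..x_k are var 0 .. var (k-1))

Prefix : (State → State) → State → Set
Prefix r s = r s ⊆ₛ s

-- the function α_i for variable i (λ s. 0 for variables outside x_1..x_k,
-- which do not occur in A)
lookupα : {k : ℕ} → Vec SN k → Var → SN
lookupα [] x = λ _ → 0
lookupα (a ∷ as) zero = a
lookupα (a ∷ as) (suc x) = lookupα as x

_⊩_∶_ : {k : ℕ} → (State → State) → Vec SN k → Form → Set
r ⊩ α ∶ A = ∀ s → Prefix r s → ⟦ A ⟧ᶠ (λ x _ → lookupα α x s) s ≡ true

module Submission where

-- Since ⟦_⟧ᶠ is a Boolean-valued,
-- compositional interpretation, the propositional axioms are Boolean
-- tautologies, and the substitution lemma  ⟦ A[t/x] ⟧ ξ = ⟦ A ⟧ (ξ[x ≔ ⟦t⟧ ξ])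
-- handles the equality axioms and the substitution and induction rules.
-- The one non-standard axiom is (φ): χ_P(m⃗) → P(m⃗, φ_P(m⃗)).  It holds at
-- every state s: χ_P(m⃗) is true at s only if lookup finds an entry
-- ⟨P, m⃗, n⟩ in s, and then φ_P(m⃗) = n and P(m⃗, n) holds because states
-- contain only true entries; this needs the Boolean comparisons used by
-- lookup to be sound.

open import Defs
open import Data.Nat using (ℕ; zero; suc; _≡ᵇ_)
open import Data.Nat.Properties using (≡ᵇ⇒≡; ≡⇒≡ᵇ)
open import Data.Bool using (Bool; true; false; not; _∧_; _∨_; if_then_else_)
open import Data.Bool.Properties using (T-≡; ∨-inverseˡ)
open import Data.Vec using (Vec; []; _∷_; _∷ʳ_; lookup; map)
open import Data.Fin using (Fin; toℕ)
open import Data.Fin.Properties using (toℕ-injective)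
open import Data.List using (List; []; _∷_)
open import Data.List.Relation.Unary.All using (All; []; _∷_)
open import Data.Maybe using (just; nothing)
open import Data.Product using (Σ; _×_; _,_)
open import Function.Bundles using (Equivalence)
open import Relation.Binary.PropositionalEquality
  using (_≡_; refl; sym; trans; cong; cong₂; module ≡-Reasoning)

∧-split : ∀ {a b} → a ∧ b ≡ true → a ≡ true × b ≡ true
∧-split {true} {true} _ = refl , refl

≡ᵇ-sound : ∀ {m n} → (m ≡ᵇ n) ≡ true → m ≡ n
≡ᵇ-sound {m} {n} e = ≡ᵇ⇒≡ m n (Equivalence.from T-≡ e)

≡ᵇ-complete : ∀ {m n} → m ≡ n → (m ≡ᵇ n) ≡ true
≡ᵇ-complete {m} {n} e = Equivalence.to T-≡ (≡⇒≡ᵇ m n e)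

≡ᵇ-refl : ∀ n → (n ≡ᵇ n) ≡ true
≡ᵇ-refl n = ≡ᵇ-complete {n} refl

⇒-elim : ∀ {a b} → not a ∨ b ≡ true → a ≡ true → b ≡ true
⇒-elim {true} e refl = e

-- A Boolean function that is true at all assignments (conjoined in Table₂)
-- is valid; the propositional axioms are Boolean tautologies checked this way.
Table₂ : (Bool → Bool → Bool) → Bool
Table₂ f = f true true ∧ f true false ∧ f false true ∧ f false false

valid₂ : (f : Bool → Bool → Bool) → Table₂ f ≡ true → ∀ a b → f a b ≡ true
valid₂ f e a b with ∧-split {f true true} e
... | tt , e₁ with ∧-split {f true false} e₁
... | tf , e₂ with ∧-split {f false true} e₂
... | ft , ff with a | b
... | true  | true  = tt
... | true  | false = tf
... | false | true  = ft
... | false | false = ff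

valid₃ : (f : Bool → Bool → Bool → Bool) → Table₂ (f true) ∧ Table₂ (f false) ≡ true →
  ∀ a b c → f a b c ≡ true
valid₃ f e a b c with ∧-split {Table₂ (f true)} e
... | e-true , e-false with a
... | true  = valid₂ (f true) e-true b c
... | false = valid₂ (f false) e-false b c

-- Soundness of the syntactic equality tests on codes.  Codes of
-- different arities are compared, so soundness is stated as equality of
-- the dependent pairs (arity , code).

mutual
  eqPR-sound : ∀ {a b} (f : PR a) (g : PR b) → eqPR f g ≡ true →
    _≡_ {A = Σ ℕ PR} (a , f) (b , g)
  eqPR-sound Z Z _ = refl
  eqPR-sound S S _ = refl
  eqPR-sound (P {a} i) (P {b} j) e with ∧-split {a ≡ᵇ b} e
  ... | a≡b , i≡j with ≡ᵇ-sound {a} {b} a≡b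
  ... | refl with toℕ-injective (≡ᵇ-sound {toℕ i} {toℕ j} i≡j)
  ... | refl = refl
  eqPR-sound (C {n = a} f gs) (C {n = b} f′ gs′) e with ∧-split {a ≡ᵇ b} e
  ... | a≡b , e′ with ≡ᵇ-sound {a} {b} a≡b | ∧-split {eqPR f f′} e′
  ... | refl | f≡f′ , gs≡gs′ with eqPR-sound f f′ f≡f′ | eqPRV-sound gs gs′ gs≡gs′
  ... | refl | refl = refl
  eqPR-sound (R g h) (R g′ h′) e with ∧-split {eqPR g g′} e
  ... | g≡g′ , h≡h′ with eqPR-sound g g′ g≡g′ | eqPR-sound h h′ h≡h′
  ... | refl | refl = refl
  eqPR-sound Z S ()
  eqPR-sound Z (P _) ()
  eqPR-sound Z (C _ _) ()
  eqPR-sound Z (R _ _) ()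
  eqPR-sound S Z ()
  eqPR-sound S (P _) ()
  eqPR-sound S (C _ _) ()
  eqPR-sound S (R _ _) ()
  eqPR-sound (P _) Z ()
  eqPR-sound (P _) S ()
  eqPR-sound (P _) (C _ _) ()
  eqPR-sound (P _) (R _ _) ()
  eqPR-sound (C _ _) Z ()
  eqPR-sound (C _ _) S ()
  eqPR-sound (C _ _) (P _) ()
  eqPR-sound (C _ _) (R _ _) ()
  eqPR-sound (R _ _) Z ()
  eqPR-sound (R _ _) S ()
  eqPR-sound (R _ _) (P _) ()
  eqPR-sound (R _ _) (C _ _) ()

  eqPRV-sound : ∀ {a m n} (fs : Vec (PR a) m) (gs : Vec (PR a) n) → eqPRV fs gs ≡ true →
    _≡_ {A = Σ ℕ (Vec (PR a))} (m , fs) (n , gs)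
  eqPRV-sound [] [] _ = refl
  eqPRV-sound (f ∷ fs) (g ∷ gs) e with ∧-split {eqPR f g} e
  ... | f≡g , fs≡gs with eqPR-sound f g f≡g | eqPRV-sound fs gs fs≡gs
  ... | refl | refl = refl
  eqPRV-sound [] (_ ∷ _) ()
  eqPRV-sound (_ ∷ _) [] ()

eqVecℕ-sound : ∀ {a b} (u : Vec ℕ a) (v : Vec ℕ b) → eqVecℕ u v ≡ true →
  _≡_ {A = Σ ℕ (Vec ℕ)} (a , u) (b , v)
eqVecℕ-sound [] [] _ = refl
eqVecℕ-sound (x ∷ xs) (y ∷ ys) e with ∧-split {x ≡ᵇ y} e
... | x≡y , xs≡ys with ≡ᵇ-sound {x} {y} x≡y | eqVecℕ-sound xs ys xs≡ys
... | refl | refl = refl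
eqVecℕ-sound [] (_ ∷ _) ()
eqVecℕ-sound (_ ∷ _) [] ()

eqPS-sound : ∀ {k} (p q : PredSym k) → eqPS p q ≡ true → p ≡ q
eqPS-sound eqP eqP _ = refl
eqPS-sound (prP f) (prP g) e with eqPR-sound f g e
... | refl = refl
eqPS-sound eqP (prP _) ()
eqPS-sound (prP _) eqP ()

findEntry-sound : ∀ {k} (es : List Entry) (p : PredSym (suc k)) (ms : Vec ℕ k) {n : ℕ} →
  All (λ e → holdsP (pred e) (args e ∷ʳ val e) ≡ true) es →
  findEntry es p ms ≡ just n → holdsP p (ms ∷ʳ n) ≡ true
findEntry-sound [] p ms [] ()
findEntry-sound (⟨ q , as , v ⟩ ∷ es) p ms (q-sound ∷ es-sound) found
  with eqPS q p ∧ eqVecℕ as ms in match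
... | false = findEntry-sound es p ms es-sound found
... | true with ∧-split {eqPS q p} match
... | q≡p , as≡ms with eqVecℕ-sound as ms as≡ms
... | refl with eqPS-sound q p q≡p | found
... | refl | refl = q-sound

φ-sound : ∀ {k} (p : PredSym (suc k)) (ms : Vec ℕ k) (s : State) →
  not (semχ p ms s) ∨ holdsP p (ms ∷ʳ semφ p ms s) ≡ true
φ-sound p ms s with findEntry (entries s) p ms in found
... | nothing = refl
... | just n = findEntry-sound (entries s) p ms (sound s) found

_[_≔_] : Env → Var → SN → Env
(ξ [ x ≔ f ]) y = if x ≡ᵇ y then f else ξ y

Agree : Env → Env → State → Set
Agree ξ ξ′ s = ∀ v → ξ v s ≡ ξ′ v s

update-agree : ∀ ξ x {f g : SN} s → f s ≡ g s → Agree (ξ [ x ≔ f ]) (ξ [ x ≔ g ]) s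
update-agree ξ x s f≡g v with x ≡ᵇ v
... | true = f≡g
... | false = refl

update-shadow : ∀ ξ x (f g : SN) s → Agree (ξ [ x ≔ f ] [ x ≔ g ]) (ξ [ x ≔ g ]) s
update-shadow ξ x f g s v with x ≡ᵇ v
... | true = refl
... | false = refl

update-lookup : ∀ ξ x (f : SN) s → (ξ [ x ≔ f ]) x s ≡ f s
update-lookup ξ x f s rewrite ≡ᵇ-refl x = refl

mutual
  coincideᵗ : ∀ {ξ ξ′ s} → Agree ξ ξ′ s → (t : Term) → ⟦ t ⟧ᵗ ξ s ≡ ⟦ t ⟧ᵗ ξ′ s
  coincideᵗ ag (var x) = ag x
  coincideᵗ ag zer = refl
  coincideᵗ ag (succ t) = cong suc (coincideᵗ ag t)
  coincideᵗ ag (fn f ts) = cong (evalPR f) (coincideᵛ ag ts)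
  coincideᵗ {s = s} ag (φ p ts) = cong (λ ms → semφ p ms s) (coincideᵛ ag ts)

  coincideᵛ : ∀ {k ξ ξ′ s} → Agree ξ ξ′ s → (ts : Vec Term k) → ⟦ ts ⟧ᵛ ξ s ≡ ⟦ ts ⟧ᵛ ξ′ s
  coincideᵛ ag [] = refl
  coincideᵛ ag (t ∷ ts) = cong₂ _∷_ (coincideᵗ ag t) (coincideᵛ ag ts)

coincideᶠ : ∀ {ξ ξ′ s} → Agree ξ ξ′ s → (A : Form) → ⟦ A ⟧ᶠ ξ s ≡ ⟦ A ⟧ᶠ ξ′ s
coincideᶠ ag (atom p ts) = cong (holdsP p) (coincideᵛ ag ts)
coincideᶠ {s = s} ag (χ p ts) = cong (λ ms → semχ p ms s) (coincideᵛ ag ts)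
coincideᶠ ag (¬' A) = cong not (coincideᶠ ag A)
coincideᶠ ag (A ∧' B) = cong₂ _∧_ (coincideᶠ ag A) (coincideᶠ ag B)
coincideᶠ ag (A ∨' B) = cong₂ _∨_ (coincideᶠ ag A) (coincideᶠ ag B)
coincideᶠ ag (A ⇒ B) = cong₂ (λ a b → not a ∨ b) (coincideᶠ ag A) (coincideᶠ ag B)

mutual
  substᵗ-sem : ∀ x t ξ s (u : Term) → ⟦ substT x t u ⟧ᵗ ξ s ≡ ⟦ u ⟧ᵗ (ξ [ x ≔ ⟦ t ⟧ᵗ ξ ]) s
  substᵗ-sem x t ξ s (var y) with x ≡ᵇ y
  ... | true = refl
  ... | false = refl
  substᵗ-sem x t ξ s zer = refl
  substᵗ-sem x t ξ s (succ u) = cong suc (substᵗ-sem x t ξ s u)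
  substᵗ-sem x t ξ s (fn f us) = cong (evalPR f) (substᵛ-sem x t ξ s us)
  substᵗ-sem x t ξ s (φ p us) = cong (λ ms → semφ p ms s) (substᵛ-sem x t ξ s us)

  substᵛ-sem : ∀ {k} x t ξ s (us : Vec Term k) →
    ⟦ substV x t us ⟧ᵛ ξ s ≡ ⟦ us ⟧ᵛ (ξ [ x ≔ ⟦ t ⟧ᵗ ξ ]) s
  substᵛ-sem x t ξ s [] = refl
  substᵛ-sem x t ξ s (u ∷ us) = cong₂ _∷_ (substᵗ-sem x t ξ s u) (substᵛ-sem x t ξ s us)

substᶠ-sem : ∀ x t ξ s (A : Form) → ⟦ substF x t A ⟧ᶠ ξ s ≡ ⟦ A ⟧ᶠ (ξ [ x ≔ ⟦ t ⟧ᵗ ξ ]) s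
substᶠ-sem x t ξ s (atom p ts) = cong (holdsP p) (substᵛ-sem x t ξ s ts)
substᶠ-sem x t ξ s (χ p ts) = cong (λ ms → semχ p ms s) (substᵛ-sem x t ξ s ts)
substᶠ-sem x t ξ s (¬' A) = cong not (substᶠ-sem x t ξ s A)
substᶠ-sem x t ξ s (A ∧' B) = cong₂ _∧_ (substᶠ-sem x t ξ s A) (substᶠ-sem x t ξ s B)
substᶠ-sem x t ξ s (A ∨' B) = cong₂ _∨_ (substᶠ-sem x t ξ s A) (substᶠ-sem x t ξ s B)
substᶠ-sem x t ξ s (A ⇒ B) =
  cong₂ (λ a b → not a ∨ b) (substᶠ-sem x t ξ s A) (substᶠ-sem x t ξ s B)

snoc-sem : ∀ {k} (ts : Vec Term k) t ξ s → ⟦ ts ∷ʳ t ⟧ᵛ ξ s ≡ ⟦ ts ⟧ᵛ ξ s ∷ʳ ⟦ t ⟧ᵗ ξ s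
snoc-sem [] t ξ s = refl
snoc-sem (u ∷ ts) t ξ s = cong (⟦ u ⟧ᵗ ξ s ∷_) (snoc-sem ts t ξ s)

lookup-sem : ∀ {n} (ts : Vec Term n) (i : Fin n) ξ s →
  lookup (⟦ ts ⟧ᵛ ξ s) i ≡ ⟦ lookup ts i ⟧ᵗ ξ s
lookup-sem (t ∷ ts) Fin.zero ξ s = refl
lookup-sem (t ∷ ts) (Fin.suc i) ξ s = lookup-sem ts i ξ s

compose-sem : ∀ {k n} (gs : Vec (PR n) k) (ts : Vec Term n) ξ s →
  evalPRV gs (⟦ ts ⟧ᵛ ξ s) ≡ ⟦ map (λ g → fn g ts) gs ⟧ᵛ ξ s
compose-sem [] ts ξ s = refl
compose-sem (g ∷ gs) ts ξ s = cong (evalPR g (⟦ ts ⟧ᵛ ξ s) ∷_) (compose-sem gs ts ξ s)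

subst-cong : ∀ x t u A ξ s → ⟦ t ⟧ᵗ ξ s ≡ ⟦ u ⟧ᵗ ξ s →
  ⟦ substF x t A ⟧ᶠ ξ s ≡ ⟦ substF x u A ⟧ᶠ ξ s
subst-cong x t u A ξ s t≡u = begin
  ⟦ substF x t A ⟧ᶠ ξ s              ≡⟨ substᶠ-sem x t ξ s A ⟩
  ⟦ A ⟧ᶠ (ξ [ x ≔ ⟦ t ⟧ᵗ ξ ]) s      ≡⟨ coincideᶠ (update-agree ξ x s t≡u) A ⟩
  ⟦ A ⟧ᶠ (ξ [ x ≔ ⟦ u ⟧ᵗ ξ ]) s      ≡⟨ substᶠ-sem x u ξ s A ⟨
  ⟦ substF x u A ⟧ᶠ ξ s              ∎
  where open ≡-Reasoning

induction-sem : ∀ x A → (∀ ξ s → ⟦ substF x zer A ⟧ᶠ ξ s ≡ true) →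
  (∀ ξ s → ⟦ A ⇒ substF x (succ (var x)) A ⟧ᶠ ξ s ≡ true) →
  ∀ ξ s n → ⟦ A ⟧ᶠ (ξ [ x ≔ (λ _ → n) ]) s ≡ true
induction-sem x A base step ξ s zero = trans (sym (substᶠ-sem x zer ξ s A)) (base ξ s)
induction-sem x A base step ξ s (suc n) = begin
  ⟦ A ⟧ᶠ (ξ [ x ≔ (λ _ → suc n) ]) s            ≡⟨ coincideᶠ successor-update A ⟨
  ⟦ A ⟧ᶠ (ξₙ [ x ≔ ⟦ succ (var x) ⟧ᵗ ξₙ ]) s    ≡⟨ substᶠ-sem x (succ (var x)) ξₙ s A ⟨
  ⟦ substF x (succ (var x)) A ⟧ᶠ ξₙ s           ≡⟨ ⇒-elim (step ξₙ s) (induction-sem x A base step ξ s n) ⟩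
  true                                          ∎
  where
  open ≡-Reasoning
  ξₙ : Env
  ξₙ = ξ [ x ≔ (λ _ → n) ]
  successor-update : Agree (ξₙ [ x ≔ ⟦ succ (var x) ⟧ᵗ ξₙ ]) (ξ [ x ≔ (λ _ → suc n) ]) s
  successor-update v =
    trans (update-agree ξₙ x s (cong suc (update-lookup ξ x (λ _ → n) s)) v)
          (update-shadow ξ x (λ _ → n) (λ _ → suc n) s v)

soundness : ∀ {A} → ⊢ A → (ξ : Env) (s : State) → ⟦ A ⟧ᶠ ξ s ≡ true
soundness (ax1 A B) ξ s = valid₂ (λ a b → not a ∨ (not b ∨ a)) refl (⟦ A ⟧ᶠ ξ s) (⟦ B ⟧ᶠ ξ s)
soundness (ax2 A B D) ξ s =
  valid₃ (λ a b c → not (not a ∨ b) ∨ (not (not a ∨ (not b ∨ c)) ∨ (not a ∨ c))) refl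
         (⟦ A ⟧ᶠ ξ s) (⟦ B ⟧ᶠ ξ s) (⟦ D ⟧ᶠ ξ s)
soundness (ax3 A B) ξ s = valid₂ (λ a b → not a ∨ (not b ∨ (a ∧ b))) refl (⟦ A ⟧ᶠ ξ s) (⟦ B ⟧ᶠ ξ s)
soundness (ax4 A B) ξ s = valid₂ (λ a b → not (a ∧ b) ∨ a) refl (⟦ A ⟧ᶠ ξ s) (⟦ B ⟧ᶠ ξ s)
soundness (ax5 A B) ξ s = valid₂ (λ a b → not (a ∧ b) ∨ b) refl (⟦ A ⟧ᶠ ξ s) (⟦ B ⟧ᶠ ξ s)
soundness (ax6 A B) ξ s = valid₂ (λ a b → not a ∨ (a ∨ b)) refl (⟦ A ⟧ᶠ ξ s) (⟦ B ⟧ᶠ ξ s)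
soundness (ax7 A B) ξ s = valid₂ (λ a b → not b ∨ (a ∨ b)) refl (⟦ A ⟧ᶠ ξ s) (⟦ B ⟧ᶠ ξ s)
soundness (ax8 A B D) ξ s =
  valid₃ (λ a b c → not (not a ∨ c) ∨ (not (not b ∨ c) ∨ (not (a ∨ b) ∨ c))) refl
         (⟦ A ⟧ᶠ ξ s) (⟦ B ⟧ᶠ ξ s) (⟦ D ⟧ᶠ ξ s)
soundness (ax9 A B) ξ s =
  valid₂ (λ a b → not (not a ∨ b) ∨ (not (not a ∨ not b) ∨ not a)) refl (⟦ A ⟧ᶠ ξ s) (⟦ B ⟧ᶠ ξ s)
soundness (ax10 A B) ξ s = valid₂ (λ a b → not (not a) ∨ (not a ∨ b)) refl (⟦ A ⟧ᶠ ξ s) (⟦ B ⟧ᶠ ξ s)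
soundness (eq-refl t) ξ s = ≡ᵇ-refl (⟦ t ⟧ᵗ ξ s)
soundness (eq-subst x t u A) ξ s with ⟦ t ⟧ᵗ ξ s ≡ᵇ ⟦ u ⟧ᵗ ξ s in t≡u
... | false = refl
... | true rewrite subst-cong x t u A ξ s (≡ᵇ-sound t≡u) = ∨-inverseˡ (⟦ substF x u A ⟧ᶠ ξ s)
soundness defZ ξ s = refl
soundness (defS t) ξ s = ≡ᵇ-refl (suc (⟦ t ⟧ᵗ ξ s))
soundness (defP i ts) ξ s = ≡ᵇ-complete (lookup-sem ts i ξ s)
soundness (defC f gs ts) ξ s = ≡ᵇ-complete (cong (evalPR f) (compose-sem gs ts ξ s))
soundness (defR0 g h ts) ξ s = ≡ᵇ-refl (evalPR g (⟦ ts ⟧ᵛ ξ s))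
soundness (defRS g h t ts) ξ s = ≡ᵇ-refl (evalPR (R g h) (⟦ succ t ∷ ts ⟧ᵛ ξ s))
-- the defining axioms of predicate symbols have the form  a ⇒ a  semantically
soundness (defPr₁ f ts) ξ s = ∨-inverseˡ (evalPR f (⟦ ts ⟧ᵛ ξ s) ≡ᵇ 0)
soundness (defPr₂ f ts) ξ s = ∨-inverseˡ (evalPR f (⟦ ts ⟧ᵛ ξ s) ≡ᵇ 0)
soundness succ≠0 ξ s = refl
soundness (axφ p ts) ξ s rewrite snoc-sem ts (φ p ts) ξ s = φ-sound p (⟦ ts ⟧ᵛ ξ s) s
soundness (mp d e) ξ s = ⇒-elim (soundness d ξ s) (soundness e ξ s)
soundness (sub {A} x t d) ξ s = trans (substᶠ-sem x t ξ s A) (soundness d (ξ [ x ≔ ⟦ t ⟧ᵗ ξ ]) s)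
soundness (ind {A} x y d₀ dₛ) ξ s = begin
  ⟦ substF x (var y) A ⟧ᶠ ξ s                ≡⟨ substᶠ-sem x (var y) ξ s A ⟩
  ⟦ A ⟧ᶠ (ξ [ x ≔ ξ y ]) s                    ≡⟨ coincideᶠ (update-agree ξ x s refl) A ⟩
  ⟦ A ⟧ᶠ (ξ [ x ≔ (λ _ → ξ y s) ]) s          ≡⟨ induction-sem x A (soundness d₀) (soundness dₛ) ξ s (ξ y s) ⟩
  true                                        ∎
  where open ≡-Reasoning

corollary6p18 : (A : Form) → ⊢ A →
    ((ξ : Env) (s : State) → ⟦ A ⟧ᶠ ξ s ≡ true)
    × ((k : ℕ) (α : Vec SN k) → VarsBelowF k A → (λ _ → ⊥ₛ) ⊩ α ∶ A)
corollary6p18 A ⊢A = soundness ⊢A , realized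
  where
  -- the realizability condition at s is truth at s in the environment given by α⃗
  realized : (k : ℕ) (α : Vec SN k) → VarsBelowF k A → (λ _ → ⊥ₛ) ⊩ α ∶ A
  realized k α _ s _ = soundness ⊢A (λ x _ → lookupα α x s) s
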